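{- Let $k \geq 1$ and let $\lambda$ be a number with $q_k(\lambda) = 0$. Then for all integers $a \geq 1$ and $0 \leq b \leq k$, $$q_{a(k+1) + b}(\lambda) = \left(q_{k+1}(\lambda)\right)^a q_b(\lambda).$$
   Context: The path $P_n$ is the graph with vertex set $[n]=\{1,\dots,n\}$ and edges $\{i,i+1\}$ for $i \in [n-1]$. For $n \ge 1$, $q_n(x)=\det(\mathbf{A}(P_n)-x\mathbf{I}_n)$, where $\mathbf{A}(P_n)$ is the adjacency matrix of $P_n$; by convention $q_0(x)=1$. -}

module Defs where

open import Level using (Level)
open import Algebra.Bundles using (CommutativeRing)
open import Data.Nat as ℕ using (ℕ; zero; suc)
open import Data.Fin as Fin using (Fin; zero; suc; toℕ; punchIn)
open import Data.Bool using (if_then_else_; _∨_)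
open import Relation.Nullary using (does)

module _ {c ℓ : Level} (R : CommutativeRing c ℓ) where
  open CommutativeRing R using (Carrier; _+_; _*_; -_; _-_; 0#; 1#)

  Matrix : ℕ → Set c
  Matrix n = Fin n → Fin n → Carrier

  sumFin : (n : ℕ) → (Fin n → Carrier) → Carrier
  sumFin zero f = 0#
  sumFin (suc n) f = f zero + sumFin n (λ i → f (suc i))

  sgn : {n : ℕ} → Fin n → Carrier
  sgn zero = 1#
  sgn (suc j) = - sgn j

  minor : {n : ℕ} → Matrix (suc n) → Fin (suc n) → Matrix n
  minor M j r s = M (suc r) (punchIn j s)

  det : (n : ℕ) → Matrix n → Carrier
  det zero M = 1#
  det (suc n) M = sumFin (suc n) (λ j → sgn j * (M zero j * det n (minor M j)))

  -- adjacency matrix of the path P_n (vertex i+1 ↔ index i : Fin n);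
  -- i ~ j iff |i - j| = 1
  adjP : (n : ℕ) → Matrix n
  adjP n i j = if does (toℕ i ℕ.≟ suc (toℕ j)) ∨ does (toℕ j ℕ.≟ suc (toℕ i))
               then 1# else 0#

  idM : (n : ℕ) → Matrix n
  idM n i j = if does (i Fin.≟ j) then 1# else 0#

  q : ℕ → Carrier → Carrier
  q n x = det n (λ i j → adjP n i j - x * idM n i j)

  pow : Carrier → ℕ → Carrier
  pow y zero = 1#
  pow y (suc a) = y * pow y a

-- Expanding det (A(P_n) − x I) along the first row gives the three-term
-- recurrence q_{n+2} = −x q_{n+1} − q_n with q_0 = 1 and q_1 = −x. For any
-- second-order linear recurrence s with s_0 = 1 and s_1 equal to the leading
-- coefficient, the vanishing of s_k makes n ↦ s_{n+k+1} satisfy the same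
-- recurrence with initial values s_{k+1}·s_0 and s_{k+1}·s_1, so
-- s_{n+k+1} = s_{k+1} s_n; iterating this a times gives the theorem.
module Submission where

open import Defs
open import Level using (Level)
open import Algebra.Bundles using (CommutativeRing)
open import Data.Nat as ℕ using (ℕ; zero; suc)
import Data.Nat.Properties as ℕₚ
open import Data.Fin using (Fin; zero; suc)
open import Data.Product using (_×_; _,_; proj₁)
open import Relation.Binary.PropositionalEquality using (cong)
import Relation.Binary.Reasoning.Setoid as SetoidReasoning
import Algebra.Properties.Ring as RingProperties
import Algebra.Properties.CommutativeSemigroup as CommutativeSemigroupProperties

module _ {c ℓ : Level} (R : CommutativeRing c ℓ) where
  open CommutativeRing R hiding (zero)
  open SetoidReasoning setoid
  open RingProperties ring using (-1*x≈-x; -0#≈0#)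
  open CommutativeSemigroupProperties *-commutativeSemigroup using (x∙yz≈y∙xz)

  private
    *-zeroʳ-inner : ∀ a b {d} → d ≈ 0# → a * (b * d) ≈ 0#
    *-zeroʳ-inner a b d≈0 = trans (*-congˡ (trans (*-congˡ d≈0) (zeroʳ b))) (zeroʳ a)

    *-zeroˡ-inner : ∀ a b {d} → d ≈ 0# → a * (d * b) ≈ 0#
    *-zeroˡ-inner a b d≈0 = trans (*-congˡ (trans (*-congʳ d≈0) (zeroˡ b))) (zeroʳ a)

  sumFin-≈0 : ∀ n (f : Fin n → Carrier) → (∀ i → f i ≈ 0#) → sumFin R n f ≈ 0#
  sumFin-≈0 zero    f f≈0 = refl
  sumFin-≈0 (suc n) f f≈0 =
    trans (+-cong (f≈0 zero) (sumFin-≈0 n _ (λ i → f≈0 (suc i)))) (+-identityˡ 0#)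

  det-firstColumn≈0 : ∀ n (M : Matrix R (suc n)) → (∀ r → M r zero ≈ 0#) →
                      det R (suc n) M ≈ 0#
  det-firstColumn≈0 zero    M col≈0 = trans (+-identityʳ _) (*-zeroˡ-inner _ _ (col≈0 zero))
  det-firstColumn≈0 (suc n) M col≈0 =
    trans (+-cong (*-zeroˡ-inner _ _ (col≈0 zero)) (sumFin-≈0 (suc n) _ minor≈0)) (+-identityˡ 0#)
    where
    minor≈0 : ∀ j → sgn R (suc j) * (M zero (suc j) * det R (suc n) (minor R M (suc j))) ≈ 0#
    minor≈0 j = *-zeroʳ-inner _ _ (det-firstColumn≈0 n (minor R M (suc j)) (λ r → col≈0 (suc r)))

  det-firstColumn-zeroBelow : ∀ n (M : Matrix R (suc n)) → (∀ r → M (suc r) zero ≈ 0#) →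
                              det R (suc n) M ≈ M zero zero * det R n (minor R M zero)
  det-firstColumn-zeroBelow zero    M below≈0 = trans (+-identityʳ _) (*-identityˡ _)
  det-firstColumn-zeroBelow (suc n) M below≈0 =
    trans (+-cong (*-identityˡ _) (sumFin-≈0 (suc n) _ minor≈0)) (+-identityʳ _)
    where
    minor≈0 : ∀ j → sgn R (suc j) * (M zero (suc j) * det R (suc n) (minor R M (suc j))) ≈ 0#
    minor≈0 j = *-zeroʳ-inner _ _ (det-firstColumn≈0 n (minor R M (suc j)) below≈0)

  det-tridiagonal : ∀ n (M : Matrix R (suc (suc n))) {d b c} →
    M zero zero ≈ d → M zero (suc zero) ≈ b → (∀ j → M zero (suc (suc j)) ≈ 0#) →
    M (suc zero) zero ≈ c → (∀ r → M (suc (suc r)) zero ≈ 0#) →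
    det R (suc (suc n)) M
      ≈ d * det R (suc n) (minor R M zero)
        - b * (c * det R n (minor R (minor R M (suc zero)) zero))
  det-tridiagonal n M {d} {b} {c} m₀₀ m₀₁ row≈0 m₁₀ col≈0 = begin
      det R (suc (suc n)) M
    ≈⟨ +-cong (*-congˡ (*-congʳ m₀₀))
         (+-cong (*-congˡ (*-cong m₀₁ (trans second-minor (*-congʳ m₁₀))))
                 (sumFin-≈0 n _ (λ j → *-zeroˡ-inner _ _ (row≈0 j)))) ⟩
      1# * (d * D) + (- 1# * (b * (c * E)) + 0#)
    ≈⟨ +-cong (*-identityˡ _) (trans (+-identityʳ _) (-1*x≈-x _)) ⟩
      d * D - b * (c * E) ∎
    where
    D = det R (suc n) (minor R M zero)
    E = det R n (minor R (minor R M (suc zero)) zero)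
    second-minor : det R (suc n) (minor R M (suc zero)) ≈ M (suc zero) zero * E
    second-minor = det-firstColumn-zeroBelow n (minor R M (suc zero)) col≈0

  SecondOrderRecurrence : Carrier → Carrier → (ℕ → Carrier) → Set ℓ
  SecondOrderRecurrence α β s = ∀ n → s (suc (suc n)) ≈ α * s (suc n) + β * s n

  module _ {α β : Carrier} where

    secondOrder-unique : ∀ {s t} → SecondOrderRecurrence α β s → SecondOrderRecurrence α β t →
                         s 0 ≈ t 0 → s 1 ≈ t 1 → ∀ n → s n ≈ t n
    secondOrder-unique {s} {t} rec-s rec-t s₀ s₁ n = proj₁ (consecutive n)
      where
      consecutive : ∀ n → s n ≈ t n × s (suc n) ≈ t (suc n)
      consecutive zero    = s₀ , s₁
      consecutive (suc n) with consecutive n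
      ... | sₙ , sₙ₊₁ = sₙ₊₁ , trans (rec-s n) (trans (+-cong (*-congˡ sₙ₊₁) (*-congˡ sₙ)) (sym (rec-t n)))

    secondOrder-scale : ∀ {s} (γ : Carrier) → SecondOrderRecurrence α β s →
                        SecondOrderRecurrence α β (λ n → γ * s n)
    secondOrder-scale {s} γ rec n = begin
      γ * s (suc (suc n))              ≈⟨ *-congˡ (rec n) ⟩
      γ * (α * s (suc n) + β * s n)    ≈⟨ distribˡ γ _ _ ⟩
      γ * (α * s (suc n)) + γ * (β * s n)
        ≈⟨ +-cong (x∙yz≈y∙xz γ α _) (x∙yz≈y∙xz γ β _) ⟩
      α * (γ * s (suc n)) + β * (γ * s n) ∎

    secondOrder-factor : ∀ {s} k → SecondOrderRecurrence α β s → s 0 ≈ 1# → s 1 ≈ α →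
                         s k ≈ 0# → ∀ n → s (n ℕ.+ suc k) ≈ s (suc k) * s n
    secondOrder-factor {s} k rec s₀ s₁ sₖ≈0 =
      secondOrder-unique (λ n → rec (n ℕ.+ suc k)) (secondOrder-scale (s (suc k)) rec)
        (trans (sym (*-identityʳ _)) (*-congˡ (sym s₀)))
        shifted₁
      where
      shifted₁ : s (suc (suc k)) ≈ s (suc k) * s 1
      shifted₁ = begin
        s (suc (suc k))              ≈⟨ rec k ⟩
        α * s (suc k) + β * s k      ≈⟨ +-congˡ (trans (*-congˡ sₖ≈0) (zeroʳ β)) ⟩
        α * s (suc k) + 0#           ≈⟨ +-identityʳ _ ⟩
        α * s (suc k)                ≈⟨ *-comm α _ ⟩
        s (suc k) * α                ≈⟨ *-congˡ (sym s₁) ⟩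
        s (suc k) * s 1              ∎

    secondOrder-power : ∀ {s} k → SecondOrderRecurrence α β s → s 0 ≈ 1# → s 1 ≈ α →
                        s k ≈ 0# → ∀ a b → s (a ℕ.* suc k ℕ.+ b) ≈ pow R (s (suc k)) a * s b
    secondOrder-power {s} k rec s₀ s₁ sₖ≈0 zero    b = sym (*-identityˡ _)
    secondOrder-power {s} k rec s₀ s₁ sₖ≈0 (suc a) b = begin
      s (suc k ℕ.+ a ℕ.* suc k ℕ.+ b)      ≡⟨ cong s (ℕₚ.+-assoc (suc k) (a ℕ.* suc k) b) ⟩
      s (suc k ℕ.+ (a ℕ.* suc k ℕ.+ b))    ≡⟨ cong s (ℕₚ.+-comm (suc k) _) ⟩
      s (a ℕ.* suc k ℕ.+ b ℕ.+ suc k)      ≈⟨ secondOrder-factor k rec s₀ s₁ sₖ≈0 _ ⟩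
      C * s (a ℕ.* suc k ℕ.+ b)            ≈⟨ *-congˡ (secondOrder-power k rec s₀ s₁ sₖ≈0 a b) ⟩
      C * (pow R C a * s b)                ≈⟨ sym (*-assoc _ _ _) ⟩
      pow R C (suc a) * s b                ∎
      where C = s (suc k)

  module _ (x : Carrier) where

    private
      A-xI : ∀ n → Matrix R n
      A-xI n i j = adjP R n i j - x * idM R n i j

      0-x*1≈-x : 0# - x * 1# ≈ - x
      0-x*1≈-x = trans (+-identityˡ _) (-‿cong (*-identityʳ x))

      a-x*0≈a : ∀ a → a - x * 0# ≈ a
      a-x*0≈a a = trans (+-congˡ (trans (-‿cong (zeroʳ x)) -0#≈0#)) (+-identityʳ a)

    q-one : q R 1 x ≈ - x
    q-one = trans (+-identityʳ _) (trans (*-identityˡ _) (trans (*-identityʳ _) 0-x*1≈-x))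

    -- The two minors that det-tridiagonal takes of A(P_{n+2}) − x I are
    -- definitionally A(P_{n+1}) − x I and A(P_n) − x I.
    q-recurrence : SecondOrderRecurrence (- x) (- 1#) (λ n → q R n x)
    q-recurrence n = begin
      q R (suc (suc n)) x
        ≈⟨ det-tridiagonal n (A-xI (suc (suc n))) 0-x*1≈-x (a-x*0≈a 1#) (λ _ → a-x*0≈a 0#)
                                                  (a-x*0≈a 1#) (λ _ → a-x*0≈a 0#) ⟩
      - x * q R (suc n) x - 1# * (1# * q R n x)
        ≈⟨ +-congˡ (trans (-‿cong (trans (*-identityˡ _) (*-identityˡ _))) (sym (-1*x≈-x _))) ⟩
      - x * q R (suc n) x + - 1# * q R n x ∎

    q-power : ∀ k → q R k x ≈ 0# → ∀ a b →
              q R (a ℕ.* suc k ℕ.+ b) x ≈ pow R (q R (suc k) x) a * q R b x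
    q-power k = secondOrder-power k q-recurrence refl q-one

open import Data.Nat using (_≤_; _+_)
open CommutativeRing using (Carrier; _≈_; 0#) renaming (_*_ to mul)

theorem4 : {c ℓ : Level} (R : CommutativeRing c ℓ) →
    (k : ℕ) → 1 ≤ k → (x : Carrier R) → _≈_ R (q R k x) (0# R) →
    (a b : ℕ) → 1 ≤ a → b ≤ k →
    _≈_ R (q R (a ℕ.* (k + 1) + b) x) (mul R (pow R (q R (k + 1) x) a) (q R b x))
theorem4 R k _ x qₖ≈0 a b _ _ rewrite ℕₚ.+-comm k 1 = q-power R x k qₖ≈0 a b
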